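{- Let $G$ be a graph, $M$ a module of $G$, and $X$ a minimal forbidden set of $G$. If $|X|>4$, then either $X\subseteq M$ or $|M\cap X|\le 1$.
   Context: Graphs are finite, simple, undirected. A module of $G$ is a set $M\subseteq V(G)$ such that for all $u,v\in M$ and $x\notin M$, $u\sim x$ iff $v\sim x$. A minimal forbidden set is a set $X\subseteq V(G)$ such that $G[X]$ is not an interval graph but $G[X']$ is an interval graph for every proper subset $X'\subset X$. -}

module Defs where

open import Data.Bool using (Bool; true; false)
open import Data.Nat using (ℕ; _≤_)
open import Data.Fin using (Fin)
open import Data.Fin.Subset using (Subset; _∈_; _∉_; _⊂_)
open import Data.Product using (_×_; Σ; proj₁; proj₂)
open import Relation.Binary.PropositionalEquality using (_≡_; _≢_)
open import Relation.Nullary using (¬_)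
open import Function.Bundles using (_⇔_)

record Graph (n : ℕ) : Set where
  field
    adj     : Fin n → Fin n → Bool
    symm    : ∀ u v → adj u v ≡ adj v u
    irrefl  : ∀ u → adj u u ≡ false

open Graph public

_∼[_]_ : ∀ {n} → Fin n → Graph n → Fin n → Set
u ∼[ G ] v = adj G u v ≡ true

IsModule : ∀ {n} → Graph n → Subset n → Set
IsModule G M = ∀ u v x → u ∈ M → v ∈ M → x ∉ M → (u ∼[ G ] x ⇔ v ∼[ G ] x)

Interval : Set
Interval = ℕ × ℕ

ValidInterval : Interval → Set
ValidInterval I = proj₁ I ≤ proj₂ I

Meets : Interval → Interval → Set
Meets I J = (proj₁ I ≤ proj₂ J) × (proj₁ J ≤ proj₂ I)

IsIntervalInduced : ∀ {n} → Graph n → Subset n → Set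
IsIntervalInduced {n} G X =
  Σ (Fin n → Interval) λ I →
    (∀ u → u ∈ X → ValidInterval (I u)) ×
    (∀ u v → u ∈ X → v ∈ X → u ≢ v → (u ∼[ G ] v ⇔ Meets (I u) (I v)))

IsMinimalForbidden : ∀ {n} → Graph n → Subset n → Set
IsMinimalForbidden G X =
  ¬ IsIntervalInduced G X × (∀ X′ → X′ ⊂ X → IsIntervalInduced G X′)

-- Suppose X leaves M and meets it in two vertices y₁ ≠ y₂; by minimality
-- G[X - y₂] has an interval representation.  If M ∩ X is a clique, all of
-- M ∩ X can take the interval of y₁, so G[X] would be an interval graph.
-- Otherwise pick y₁ ≁ y₂.  If two non-adjacent vertices a, b of X ∖ M are
-- adjacent to y₁ (hence to y₂), then a y₁ b y₂ is an induced C₄, a forbidden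
-- set of size 4.  If not, y₁ and its neighbours in X ∖ M form a clique, whose
-- intervals share a point t; opening a gap at t and placing there a
-- representation of the proper subgraph G[M ∩ X] again represents G[X].
module Submission where

open import Defs
open import Data.Nat using (ℕ; _<_; _≤_)
open import Data.Fin.Subset using (Subset; _⊆_; _∩_; ∣_∣)
open import Data.Sum using (_⊎_)

open import Data.Bool using (true)
import Data.Bool as Bool
open import Data.Empty using (⊥; ⊥-elim)
open import Data.Fin using (Fin; zero; suc; _≟_)
open import Data.Fin.Properties using (any?; suc-injective)
open import Data.Fin.Subset using (_∈_; _∉_; _⊂_; _∪_; _─_; _-_; ⁅_⁆; Nonempty; inside; outside)
open import Data.Fin.Subset.Properties
  using ( _∈?_; x∈⁅x⁆; x∈⁅y⁆⇒x≡y; ∣⁅x⁆∣≡1; p⊆p∪q; q⊆p∪q; x∈p∪q⁻; x∈p∩q⁺; x∈p∩q⁻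
        ; p∩q⊆q; x∈p∧x∉q⇒x∈p─q; p─q⊆p; x∈p∧x≢y⇒x∈p-y; x∈p⇒p-x⊂p; p⊆q⇒∣p∣≤∣q∣ )
open import Data.Nat using (zero; suc; z≤n; s≤s; _+_; _⊔_; _≤?_; _<?_)
open import Data.Nat.Properties
  using ( ≤-trans; ≤-reflexive; <-trans; <⇒≤; <⇒≱; ≰⇒>; ≮⇒≥; n≤1+n; m≤m+n; +-suc
        ; +-monoˡ-≤; +-monoʳ-≤; +-cancelˡ-≤; +-cancelʳ-≤; m≤m⊔n; m≤n⊔m; ⊔-lub; module ≤-Reasoning )
open import Data.Product using (_×_; _,_; proj₁; proj₂; ∃; ∃₂; swap)
  renaming (map to map×)
open import Data.Sum using (inj₁; inj₂)
open import Data.Vec.Base using ([]; _∷_; here; there)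
open import Function using (_∘_)
open import Function.Bundles using (_⇔_; mk⇔; Equivalence)
open import Function.Construct.Composition using (_⇔-∘_)
open import Relation.Binary.PropositionalEquality using (_≡_; _≢_; refl; sym; trans; cong; subst)
open import Relation.Nullary using (¬_; Dec; yes; no; ¬?)
open import Relation.Nullary.Decidable using (_×-dec_; _⊎-dec_; decidable-stable)
open import Relation.Unary using (Decidable)

open Equivalence using (to; from)

private
  variable
    n : ℕ
    x y a b c d : Fin n
    p q S T M X : Subset n
    G : Graph n

x∈p─q⇒x∉q : ∀ (p q : Subset n) → x ∈ p ─ q → x ∉ q
x∈p─q⇒x∉q (_ ∷ p) (outside ∷ q) here ()
x∈p─q⇒x∉q (_ ∷ p) (_ ∷ q) (there x∈p─q) (there x∈q) = x∈p─q⇒x∉q p q x∈p─q x∈q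

⊆⊎Nonempty─ : ∀ (p q : Subset n) → p ⊆ q ⊎ Nonempty (p ─ q)
⊆⊎Nonempty─ p q with any? (_∈? (p ─ q))
... | yes witness = inj₂ witness
... | no none     = inj₁ λ {x} x∈p →
  decidable-stable (x ∈? q) (λ x∉q → none (x , x∈p∧x∉q⇒x∈p─q x∈p x∉q))

0<∣p∣⇒Nonempty : ∀ (p : Subset n) → 0 < ∣ p ∣ → Nonempty p
0<∣p∣⇒Nonempty (inside  ∷ p) _   = zero , here
0<∣p∣⇒Nonempty (outside ∷ p) 0<∣p∣ with 0<∣p∣⇒Nonempty p 0<∣p∣
... | x , x∈p = suc x , there x∈p

1<∣p∣⇒two-elements : ∀ (p : Subset n) → 1 < ∣ p ∣ → ∃₂ λ x y → x ∈ p × y ∈ p × x ≢ y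
1<∣p∣⇒two-elements (inside ∷ p) (s≤s 0<∣p∣) with 0<∣p∣⇒Nonempty p 0<∣p∣
... | y , y∈p = zero , suc y , here , there y∈p , λ ()
1<∣p∣⇒two-elements (outside ∷ p) 1<∣p∣ with 1<∣p∣⇒two-elements p 1<∣p∣
... | x , y , x∈p , y∈p , x≢y = suc x , suc y , there x∈p , there y∈p , x≢y ∘ suc-injective

∣p∪q∣≤∣p∣+∣q∣ : ∀ (p q : Subset n) → ∣ p ∪ q ∣ ≤ ∣ p ∣ + ∣ q ∣
∣p∪q∣≤∣p∣+∣q∣ []                [] = z≤n
∣p∪q∣≤∣p∣+∣q∣ (inside  ∷ p) (inside  ∷ q) =
  s≤s (≤-trans (∣p∪q∣≤∣p∣+∣q∣ p q) (+-monoʳ-≤ ∣ p ∣ (n≤1+n ∣ q ∣)))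
∣p∪q∣≤∣p∣+∣q∣ (inside  ∷ p) (outside ∷ q) = s≤s (∣p∪q∣≤∣p∣+∣q∣ p q)
∣p∪q∣≤∣p∣+∣q∣ (outside ∷ p) (inside  ∷ q) =
  ≤-trans (s≤s (∣p∪q∣≤∣p∣+∣q∣ p q)) (≤-reflexive (sym (+-suc ∣ p ∣ ∣ q ∣)))
∣p∪q∣≤∣p∣+∣q∣ (outside ∷ p) (outside ∷ q) = ∣p∪q∣≤∣p∣+∣q∣ p q

∣⁅x⁆∪p∣≤1+∣p∣ : ∀ (x : Fin n) p → ∣ ⁅ x ⁆ ∪ p ∣ ≤ suc ∣ p ∣
∣⁅x⁆∪p∣≤1+∣p∣ x p =
  ≤-trans (∣p∪q∣≤∣p∣+∣q∣ ⁅ x ⁆ p) (≤-reflexive (cong (_+ ∣ p ∣) (∣⁅x⁆∣≡1 x)))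

⁅x⁆⊆p : x ∈ p → ⁅ x ⁆ ⊆ p
⁅x⁆⊆p {p = p} x∈p y∈⁅x⁆ = subst (_∈ p) (sym (x∈⁅y⁆⇒x≡y _ y∈⁅x⁆)) x∈p

⁅x⁆∪p⊆q : x ∈ q → p ⊆ q → ⁅ x ⁆ ∪ p ⊆ q
⁅x⁆∪p⊆q {x = x} {p = p} x∈q p⊆q y∈ with x∈p∪q⁻ ⁅ x ⁆ p y∈
... | inj₁ y∈⁅x⁆ = ⁅x⁆⊆p x∈q y∈⁅x⁆
... | inj₂ y∈p   = p⊆q y∈p

x∈⁅x⁆∪p : ∀ (x : Fin n) p → x ∈ ⁅ x ⁆ ∪ p
x∈⁅x⁆∪p x p = p⊆p∪q p (x∈⁅x⁆ x)

⁅_·_·_·_⁆ : Fin n → Fin n → Fin n → Fin n → Subset n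
⁅ a · b · c · d ⁆ = ⁅ a ⁆ ∪ ⁅ b ⁆ ∪ ⁅ c ⁆ ∪ ⁅ d ⁆

∣⁅a·b·c·d⁆∣≤4 : ∀ (a b c d : Fin n) → ∣ ⁅ a · b · c · d ⁆ ∣ ≤ 4
∣⁅a·b·c·d⁆∣≤4 a b c d =
  ≤-trans (∣⁅x⁆∪p∣≤1+∣p∣ a _) (s≤s (≤-trans (∣⁅x⁆∪p∣≤1+∣p∣ b _)
    (s≤s (≤-trans (∣⁅x⁆∪p∣≤1+∣p∣ c _) (s≤s (≤-reflexive (∣⁅x⁆∣≡1 d)))))))

⁅a·b·c·d⁆⊆ : a ∈ p → b ∈ p → c ∈ p → d ∈ p → ⁅ a · b · c · d ⁆ ⊆ p
⁅a·b·c·d⁆⊆ a∈p b∈p c∈p d∈p = ⁅x⁆∪p⊆q a∈p (⁅x⁆∪p⊆q b∈p (⁅x⁆∪p⊆q c∈p (⁅x⁆⊆p d∈p)))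

module ∈⁅a·b·c·d⁆ (a b c d : Fin n) where
  a∈ : a ∈ ⁅ a · b · c · d ⁆
  a∈ = x∈⁅x⁆∪p a _
  b∈ : b ∈ ⁅ a · b · c · d ⁆
  b∈ = q⊆p∪q ⁅ a ⁆ _ (x∈⁅x⁆∪p b _)
  c∈ : c ∈ ⁅ a · b · c · d ⁆
  c∈ = q⊆p∪q ⁅ a ⁆ _ (q⊆p∪q ⁅ b ⁆ _ (x∈⁅x⁆∪p c _))
  d∈ : d ∈ ⁅ a · b · c · d ⁆
  d∈ = q⊆p∪q ⁅ a ⁆ _ (q⊆p∪q ⁅ b ⁆ _ (q⊆p∪q ⁅ c ⁆ _ (x∈⁅x⁆ d)))

private
  variable
    I J K A B C D : Interval

_∈ᵢ_ : ℕ → Interval → Set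
z ∈ᵢ I = proj₁ I ≤ z × z ≤ proj₂ I

Meets-sym : Meets I J ⇔ Meets J I
Meets-sym = mk⇔ swap swap

valid⇒Meets-self : ValidInterval I → Meets I I
valid⇒Meets-self valid = valid , valid

¬Meets⇒separated : ¬ Meets I J → proj₂ I < proj₁ J ⊎ proj₂ J < proj₁ I
¬Meets⇒separated {I} {J} ¬meets with proj₁ I ≤? proj₂ J | proj₁ J ≤? proj₂ I
... | yes lI≤rJ | yes lJ≤rI = ⊥-elim (¬meets (lI≤rJ , lJ≤rI))
... | _         | no lJ≰rI  = inj₁ (≰⇒> lJ≰rI)
... | no lI≰rJ  | _         = inj₂ (≰⇒> lI≰rJ)

meets-across-gap : proj₂ A ≤ proj₁ B → Meets C A → Meets D B → proj₁ C ≤ proj₂ D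
meets-across-gap rA≤lB (lC≤rA , _) (_ , lB≤rD) = ≤-trans lC≤rA (≤-trans rA≤lB lB≤rD)

-- Each of C, D covers the gap between A and B.
common-neighbours-meet : ¬ Meets A B → Meets C A → Meets C B → Meets D A → Meets D B → Meets C D
common-neighbours-meet ¬AB CA CB DA DB with ¬Meets⇒separated ¬AB
... | inj₁ rA<lB = meets-across-gap (<⇒≤ rA<lB) CA DB , meets-across-gap (<⇒≤ rA<lB) DA CB
... | inj₂ rB<lA = meets-across-gap (<⇒≤ rB<lA) CB DA , meets-across-gap (<⇒≤ rB<lA) DB CA

⨆ : (Fin n → ℕ) → ℕ
⨆ {zero}  f = 0
⨆ {suc n} f = f zero ⊔ ⨆ (f ∘ suc)

≤⨆ : ∀ (f : Fin n → ℕ) i → f i ≤ ⨆ f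
≤⨆ f zero    = m≤m⊔n _ _
≤⨆ f (suc i) = ≤-trans (≤⨆ (f ∘ suc) i) (m≤n⊔m _ _)

⨆≤ : ∀ (f : Fin n → ℕ) {m} → (∀ i → f i ≤ m) → ⨆ f ≤ m
⨆≤ {zero}  f f≤m = z≤n
⨆≤ {suc n} f f≤m = ⊔-lub (f≤m zero) (⨆≤ (f ∘ suc) (f≤m ∘ suc))

-- The largest left endpoint is a common point.
helly : ∀ {P : Fin n → Set} → Decidable P → (I : Fin n → Interval) →
        (∀ {u v} → P u → P v → Meets (I u) (I v)) →
        ∃ λ z → ∀ {u} → P u → z ∈ᵢ I u
helly {P = P} P? I meets = ⨆ left , λ Pu → left≤⨆ Pu , ⨆≤ left (left≤right Pu)
  where
  left : Fin _ → ℕ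
  left u with P? u
  ... | yes _ = proj₁ (I u)
  ... | no _  = 0

  left≤⨆ : ∀ {u} → P u → proj₁ (I u) ≤ ⨆ left
  left≤⨆ {u} Pu with P? u | ≤⨆ left u
  ... | yes _ | l≤⨆ = l≤⨆
  ... | no ¬Pu | _ = ⊥-elim (¬Pu Pu)

  left≤right : ∀ {v} → P v → ∀ u → left u ≤ proj₂ (I v)
  left≤right Pv u with P? u
  ... | yes Pu = proj₁ (meets Pu Pv)
  ... | no _   = z≤n

meets-map : ∀ {f g : ℕ → ℕ} → (∀ {l r} → f l ≤ g r ⇔ l ≤ r) →
            ∀ I J → Meets I J ⇔ Meets (map× f g I) (map× f g J)
meets-map f≤g⇔ I J = mk⇔ (λ (lI≤rJ , lJ≤rI) → from f≤g⇔ lI≤rJ , from f≤g⇔ lJ≤rI)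
                         (λ (lI≤rJ , lJ≤rI) → to f≤g⇔ lI≤rJ , to f≤g⇔ lJ≤rI)

shift : ℕ → Interval → Interval
shift p = map× (p +_) (p +_)

meets-shift : ∀ p I J → Meets I J ⇔ Meets (shift p I) (shift p J)
meets-shift p = meets-map (mk⇔ (+-cancelˡ-≤ p _ _) (+-monoʳ-≤ p))

-- Opening a gap of length L at the point p: left endpoints ≤ p and right
-- endpoints < p stay, all other endpoints move right by L.  An interval
-- containing p therefore comes to contain the whole gap [p, p + L].
module Stretch (p L : ℕ) where

  pushˡ : ℕ → ℕ
  pushˡ l with l ≤? p
  ... | yes _ = l
  ... | no _  = l + L

  pushʳ : ℕ → ℕ
  pushʳ r with r <? p
  ... | yes _ = r
  ... | no _  = r + L

  stretch : Interval → Interval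
  stretch = map× pushˡ pushʳ

  pushˡ≤pushʳ⇔≤ : ∀ {l r} → pushˡ l ≤ pushʳ r ⇔ l ≤ r
  pushˡ≤pushʳ⇔≤ {l} {r} with l ≤? p | r <? p
  ... | yes _   | yes _   = mk⇔ (λ l≤r → l≤r) (λ l≤r → l≤r)
  ... | yes l≤p | no r≮p  = mk⇔ (λ _ → ≤-trans l≤p (≮⇒≥ r≮p)) (λ l≤r → ≤-trans l≤r (m≤m+n r L))
  ... | no l≰p  | yes r<p = mk⇔ (λ l+L≤r → ⊥-elim (<⇒≱ (<-trans r<p (≰⇒> l≰p)) (≤-trans (m≤m+n l L) l+L≤r)))
                               (λ l≤r → ⊥-elim (<⇒≱ (<-trans r<p (≰⇒> l≰p)) l≤r))
  ... | no _    | no _    = mk⇔ (+-cancelʳ-≤ L l r) (+-monoˡ-≤ L)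

  meets-stretch : ∀ I J → Meets I J ⇔ Meets (stretch I) (stretch J)
  meets-stretch = meets-map pushˡ≤pushʳ⇔≤

  pushˡ-≤ : ∀ {l} → l ≤ p → pushˡ l ≡ l
  pushˡ-≤ {l} l≤p with l ≤? p
  ... | yes _   = refl
  ... | no l≰p  = ⊥-elim (l≰p l≤p)

  pushʳ-≥ : ∀ {r} → p ≤ r → pushʳ r ≡ r + L
  pushʳ-≥ {r} p≤r with r <? p
  ... | yes r<p = ⊥-elim (<⇒≱ r<p p≤r)
  ... | no _    = refl

  pushˡ≤p+L⇒≤ : ∀ {l} → pushˡ l ≤ p + L → l ≤ p
  pushˡ≤p+L⇒≤ {l} pushˡl≤p+L with l ≤? p
  ... | yes l≤p = l≤p
  ... | no _    = +-cancelʳ-≤ L l p pushˡl≤p+L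

  p≤pushʳ⇒≤ : ∀ {r} → p ≤ pushʳ r → p ≤ r
  p≤pushʳ⇒≤ {r} p≤pushʳr with r <? p
  ... | yes _ = p≤pushʳr
  ... | no r≮p = ≮⇒≥ r≮p

  meets-gap : p ∈ᵢ K → (Meets K I → p ∈ᵢ I) → ValidInterval J → proj₂ J ≤ L →
              Meets K I ⇔ Meets (shift p J) (stretch I)
  meets-gap {K} {I} {J} (lK≤p , p≤rK) p∈I validJ rJ≤L = mk⇔ into back
    where
    into : Meets K I → Meets (shift p J) (stretch I)
    into KI with p∈I KI
    ... | lI≤p , p≤rI = p+lJ≤pushʳrI , ≤-trans (≤-reflexive (pushˡ-≤ lI≤p)) (≤-trans lI≤p (m≤m+n p _))
      where
      open ≤-Reasoning
      p+lJ≤pushʳrI : p + proj₁ J ≤ pushʳ (proj₂ I)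
      p+lJ≤pushʳrI = begin
        p + proj₁ J     ≤⟨ +-monoʳ-≤ p (≤-trans validJ rJ≤L) ⟩
        p + L           ≤⟨ +-monoˡ-≤ L p≤rI ⟩
        proj₂ I + L     ≡⟨ pushʳ-≥ p≤rI ⟨
        pushʳ (proj₂ I) ∎
    back : Meets (shift p J) (stretch I) → Meets K I
    back (p+lJ≤pushʳrI , pushˡlI≤p+rJ) =
        ≤-trans lK≤p (p≤pushʳ⇒≤ (≤-trans (m≤m+n p _) p+lJ≤pushʳrI))
      , ≤-trans (pushˡ≤p+L⇒≤ (≤-trans pushˡlI≤p+rJ (+-monoʳ-≤ p rJ≤L))) p≤rK

splice : Subset n → (Fin n → Interval) → (Fin n → Interval) → Fin n → Interval
splice M inner outer u with u ∈? M
... | yes _ = inner u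
... | no  _ = outer u

module _ {n} (G : Graph n) where

  ∼-sym : ∀ {u v} → u ∼[ G ] v → v ∼[ G ] u
  ∼-sym {u} {v} u∼v = trans (symm G v u) u∼v

  ∼-sym⇔ : ∀ {u v} → u ∼[ G ] v ⇔ v ∼[ G ] u
  ∼-sym⇔ = mk⇔ ∼-sym ∼-sym

  ∼⇒≢ : ∀ {u v} → u ∼[ G ] v → u ≢ v
  ∼⇒≢ {u} u∼u refl with () ← trans (sym u∼u) (irrefl G u)

  adjacent? : ∀ u v → Dec (u ∼[ G ] v)
  adjacent? u v = adj G u v Bool.≟ true

  Represents : Subset n → (Fin n → Interval) → Set
  Represents S I =
    (∀ u → u ∈ S → ValidInterval (I u)) ×
    (∀ u v → u ∈ S → v ∈ S → u ≢ v → (u ∼[ G ] v ⇔ Meets (I u) (I v)))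

  represents-mono : ∀ {I} → S ⊆ T → Represents T I → Represents S I
  represents-mono S⊆T (valid , edge) =
    (λ u u∈S → valid u (S⊆T u∈S)) , (λ u v u∈S v∈S → edge u v (S⊆T u∈S) (S⊆T v∈S))

  represents-map : ∀ {I} {h : Interval → Interval} → (∀ I J → Meets I J ⇔ Meets (h I) (h J)) →
                   Represents S I → Represents S (h ∘ I)
  represents-map {I = I} h-meets (valid , edge) =
      (λ u u∈S → proj₁ (to (h-meets (I u) (I u)) (valid⇒Meets-self (valid u u∈S))))
    , (λ u v u∈S v∈S u≢v → h-meets (I u) (I v) ⇔-∘ edge u v u∈S v∈S u≢v)

  Clique : (Fin n → Set) → Set
  Clique P = ∀ {u v} → P u → P v → u ≢ v → u ∼[ G ] v

  clique⊎non-edge : ∀ {P : Fin n → Set} → Decidable P →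
                    Clique P ⊎ ∃₂ λ u v → P u × P v × u ≢ v × ¬ u ∼[ G ] v
  clique⊎non-edge P? with any? (λ u → any? λ v →
                             P? u ×-dec P? v ×-dec ¬? (u ≟ v) ×-dec ¬? (adjacent? u v))
  ... | yes non-edge = inj₂ non-edge
  ... | no  none     = inj₁ λ {u} {v} Pu Pv u≢v →
    decidable-stable (adjacent? u v) λ u≁v → none (u , v , Pu , Pv , u≢v , u≁v)

  Clique-cone : ∀ {P} → Clique P → (∀ {u} → P u → y ∼[ G ] u) → Clique (λ u → u ≡ y ⊎ P u)
  Clique-cone clique apex (inj₁ refl) (inj₁ refl) y≢y = ⊥-elim (y≢y refl)
  Clique-cone clique apex (inj₁ refl) (inj₂ Pv)   _   = apex Pv
  Clique-cone clique apex (inj₂ Pu)   (inj₁ refl) _   = ∼-sym (apex Pu)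
  Clique-cone clique apex (inj₂ Pu)   (inj₂ Pv)   u≢v = clique Pu Pv u≢v

  clique-common-point : ∀ {I P} → Represents S I → (∀ {u} → P u → u ∈ S) → Decidable P →
                        Clique P → ∃ λ z → ∀ {u} → P u → z ∈ᵢ I u
  clique-common-point {I = I} {P} (valid , edge) P⊆S P? clique = helly P? I meets
    where
    meets : ∀ {u v} → P u → P v → Meets (I u) (I v)
    meets {u} {v} Pu Pv with u ≟ v
    ... | yes refl = valid⇒Meets-self (valid u (P⊆S Pu))
    ... | no u≢v   = to (edge u v (P⊆S Pu) (P⊆S Pv) u≢v) (clique Pu Pv u≢v)

  represents-clique : Clique (_∈ S) → ValidInterval K → Represents S (λ _ → K)
  represents-clique clique validK =
    (λ _ _ → validK) , λ u v u∈S v∈S u≢v → mk⇔ (λ _ → valid⇒Meets-self validK) (λ _ → clique u∈S v∈S u≢v)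

  record InducedC₄ (a b c d : Fin n) : Set where
    field
      a≢b : a ≢ b
      c≢d : c ≢ d
      a≁b : ¬ a ∼[ G ] b
      c≁d : ¬ c ∼[ G ] d
      c∼a : c ∼[ G ] a
      c∼b : c ∼[ G ] b
      d∼a : d ∼[ G ] a
      d∼b : d ∼[ G ] b

  ¬represents-C₄ : ∀ {I : Fin n → Interval} → InducedC₄ a b c d →
                   a ∈ S → b ∈ S → c ∈ S → d ∈ S → ¬ Represents S I
  ¬represents-C₄ {a = a} {b = b} {c = c} {d = d} {S = S} {I = I} C₄ a∈S b∈S c∈S d∈S (_ , edge) =
    c≁d (from (edge c d c∈S d∈S c≢d)
      (common-neighbours-meet (a≁b ∘ from (edge a b a∈S b∈S a≢b))
        (meets c∈S a∈S c∼a) (meets c∈S b∈S c∼b) (meets d∈S a∈S d∼a) (meets d∈S b∈S d∼b)))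
    where
    open InducedC₄ C₄
    meets : ∀ {u v : Fin n} → u ∈ S → v ∈ S → u ∼[ G ] v → Meets (I u) (I v)
    meets {u} {v} u∈S v∈S u∼v = to (edge u v u∈S v∈S (∼⇒≢ u∼v)) u∼v

  -- An induced C₄ is itself forbidden, so a larger X cannot be minimal.
  C₄⊆minimalForbidden⇒∣X∣≤4 : IsMinimalForbidden G X → InducedC₄ a b c d →
                               a ∈ X → b ∈ X → c ∈ X → d ∈ X → ∣ X ∣ ≤ 4
  C₄⊆minimalForbidden⇒∣X∣≤4 {X = X} {a = a} {b = b} {c = c} {d = d}
                            (_ , proper-interval) C₄ a∈X b∈X c∈X d∈X
    with ⊆⊎Nonempty─ X ⁅ a · b · c · d ⁆
  ... | inj₁ X⊆abcd = ≤-trans (p⊆q⇒∣p∣≤∣q∣ X⊆abcd) (∣⁅a·b·c·d⁆∣≤4 a b c d)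
  ... | inj₂ (x , x∈X─abcd) = ⊥-elim (¬represents-C₄ C₄ a∈ b∈ c∈ d∈ (proj₂ (proper-interval _ abcd⊂X)))
    where
    abcd⊂X : ⁅ a · b · c · d ⁆ ⊂ X
    abcd⊂X = ⁅a·b·c·d⁆⊆ a∈X b∈X c∈X d∈X , x , p─q⊆p X _ x∈X─abcd , x∈p─q⇒x∉q X _ x∈X─abcd
    open ∈⁅a·b·c·d⁆ a b c d

  represents-splice : ∀ {inner outer} → IsModule G M → y ∈ M →
    Represents (M ∩ X) inner → Represents (X ─ M) outer →
    (∀ {u v} → u ∈ M ∩ X → v ∈ X ─ M → (y ∼[ G ] v ⇔ Meets (inner u) (outer v))) →
    Represents X (splice M inner outer)
  represents-splice {M = M} {y = y} {X = X} {inner} {outer}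
                    M-module y∈M (inner-valid , inner-edge) (outer-valid , outer-edge) crossing =
    valid , edge
    where
    ∈M∩X : ∀ {u} → u ∈ X → u ∈ M → u ∈ M ∩ X
    ∈M∩X u∈X u∈M = x∈p∩q⁺ (u∈M , u∈X)

    ∈X─M : ∀ {u} → u ∈ X → u ∉ M → u ∈ X ─ M
    ∈X─M = x∈p∧x∉q⇒x∈p─q

    cross : ∀ {u v} → u ∈ X → u ∈ M → v ∈ X → v ∉ M → u ∼[ G ] v ⇔ Meets (inner u) (outer v)
    cross {u} {v} u∈X u∈M v∈X v∉M = crossing (∈M∩X u∈X u∈M) (∈X─M v∈X v∉M) ⇔-∘ M-module u y v u∈M y∈M v∉M

    valid : ∀ u → u ∈ X → ValidInterval (splice M inner outer u)
    valid u u∈X with u ∈? M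
    ... | yes u∈M = inner-valid u (∈M∩X u∈X u∈M)
    ... | no  u∉M = outer-valid u (∈X─M u∈X u∉M)

    edge : ∀ u v → u ∈ X → v ∈ X → u ≢ v →
           u ∼[ G ] v ⇔ Meets (splice M inner outer u) (splice M inner outer v)
    edge u v u∈X v∈X u≢v with u ∈? M | v ∈? M
    ... | yes u∈M | yes v∈M = inner-edge u v (∈M∩X u∈X u∈M) (∈M∩X v∈X v∈M) u≢v
    ... | yes u∈M | no  v∉M = cross u∈X u∈M v∈X v∉M
    ... | no  u∉M | yes v∈M = Meets-sym ⇔-∘ (cross v∈X v∈M u∈X u∉M ⇔-∘ ∼-sym⇔)
    ... | no  u∉M | no  v∉M = outer-edge u v (∈X─M u∈X u∉M) (∈X─M v∈X v∉M) u≢v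

  module Substitution {M X : Subset n} {y₁ y₂ : Fin n}
    (M-module : IsModule G M) (X-forbidden : IsMinimalForbidden G X)
    (y₁∈M∩X : y₁ ∈ M ∩ X) (y₂∈M∩X : y₂ ∈ M ∩ X) (y₁≢y₂ : y₁ ≢ y₂) where

    y₁∈M : y₁ ∈ M
    y₁∈M = proj₁ (x∈p∩q⁻ M X y₁∈M∩X)

    y₂∈M : y₂ ∈ M
    y₂∈M = proj₁ (x∈p∩q⁻ M X y₂∈M∩X)

    X-y₂-interval : IsIntervalInduced G (X - y₂)
    X-y₂-interval = proj₂ X-forbidden (X - y₂) (x∈p⇒p-x⊂p (proj₂ (x∈p∩q⁻ M X y₂∈M∩X)))

    ρ : Fin n → Interval
    ρ = proj₁ X-y₂-interval

    ρ-represents : Represents (X - y₂) ρ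
    ρ-represents = proj₂ X-y₂-interval

    X─M⊆X-y₂ : X ─ M ⊆ X - y₂
    X─M⊆X-y₂ v∈X─M = x∈p∧x≢y⇒x∈p-y (p─q⊆p X M v∈X─M) λ { refl → x∈p─q⇒x∉q X M v∈X─M y₂∈M }

    y₁∈X-y₂ : y₁ ∈ X - y₂
    y₁∈X-y₂ = x∈p∧x≢y⇒x∈p-y (proj₂ (x∈p∩q⁻ M X y₁∈M∩X)) y₁≢y₂

    y₁-edge : ∀ {v} → v ∈ X ─ M → y₁ ∼[ G ] v ⇔ Meets (ρ y₁) (ρ v)
    y₁-edge {v} v∈X─M = proj₂ ρ-represents y₁ v y₁∈X-y₂ (X─M⊆X-y₂ v∈X─M)
                          λ { refl → x∈p─q⇒x∉q X M v∈X─M y₁∈M }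

    M∩X-clique⇒⊥ : Clique (_∈ M ∩ X) → ⊥
    M∩X-clique⇒⊥ clique = proj₁ X-forbidden
      ( splice M (λ _ → ρ y₁) ρ
      , represents-splice M-module y₁∈M
          (represents-clique clique (proj₁ ρ-represents y₁ y₁∈X-y₂))
          (represents-mono X─M⊆X-y₂ ρ-represents)
          (λ _ → y₁-edge) )

    neighbourhood-clique⇒⊥ : Nonempty (X ─ M) → Clique (λ v → v ∈ X ─ M × y₁ ∼[ G ] v) → ⊥
    neighbourhood-clique⇒⊥ (z , z∈X─M) clique = proj₁ X-forbidden
      ( splice M (shift t ∘ σ) (stretch ∘ ρ)
      , represents-splice M-module y₁∈M
          (represents-map (meets-shift t) σ-represents)
          (represents-map meets-stretch (represents-mono X─M⊆X-y₂ ρ-represents))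
          crossing )
      where
      M∩X-interval : IsIntervalInduced G (M ∩ X)
      M∩X-interval = proj₂ X-forbidden (M ∩ X)
        (p∩q⊆q M X , z , p─q⊆p X M z∈X─M , x∈p─q⇒x∉q X M z∈X─M ∘ proj₁ ∘ x∈p∩q⁻ M X)

      σ : Fin n → Interval
      σ = proj₁ M∩X-interval

      σ-represents : Represents (M ∩ X) σ
      σ-represents = proj₂ M∩X-interval

      N[y₁] : Fin n → Set
      N[y₁] u = u ≡ y₁ ⊎ (u ∈ X ─ M × y₁ ∼[ G ] u)

      N[y₁]⊆X-y₂ : ∀ {u} → N[y₁] u → u ∈ X - y₂
      N[y₁]⊆X-y₂ (inj₁ refl)       = y₁∈X-y₂
      N[y₁]⊆X-y₂ (inj₂ (u∈X─M , _)) = X─M⊆X-y₂ u∈X─M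

      common-point : ∃ λ z → ∀ {u} → N[y₁] u → z ∈ᵢ ρ u
      common-point = clique-common-point ρ-represents N[y₁]⊆X-y₂
        (λ u → u ≟ y₁ ⊎-dec (u ∈? (X ─ M) ×-dec adjacent? y₁ u))
        (Clique-cone clique proj₂)

      t : ℕ
      t = proj₁ common-point

      t∈N[y₁] : ∀ {u} → N[y₁] u → t ∈ᵢ ρ u
      t∈N[y₁] = proj₂ common-point

      open Stretch t (⨆ (proj₂ ∘ σ))

      crossing : ∀ {u v} → u ∈ M ∩ X → v ∈ X ─ M → y₁ ∼[ G ] v ⇔ Meets (shift t (σ u)) (stretch (ρ v))
      crossing {u} u∈M∩X v∈X─M =
        meets-gap (t∈N[y₁] (inj₁ refl))
                  (λ meets → t∈N[y₁] (inj₂ (v∈X─M , from (y₁-edge v∈X─M) meets)))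
                  (proj₁ σ-represents u u∈M∩X) (≤⨆ (proj₂ ∘ σ) u)
          ⇔-∘ y₁-edge v∈X─M

  non-edge-in-module⇒∣X∣≤4 : IsModule G M → IsMinimalForbidden G X → Nonempty (X ─ M) →
    c ∈ M ∩ X → d ∈ M ∩ X → c ≢ d → ¬ c ∼[ G ] d → ∣ X ∣ ≤ 4
  non-edge-in-module⇒∣X∣≤4 {M = M} {X = X} {c = c} {d = d}
                           M-module X-forbidden X⊈M c∈M∩X d∈M∩X c≢d c≁d
    with clique⊎non-edge (λ v → v ∈? (X ─ M) ×-dec adjacent? c v)
  ... | inj₁ clique = ⊥-elim
    (Substitution.neighbourhood-clique⇒⊥ M-module X-forbidden c∈M∩X d∈M∩X c≢d X⊈M clique)
  ... | inj₂ (a , b , (a∈X─M , c∼a) , (b∈X─M , c∼b) , a≢b , a≁b) =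
    C₄⊆minimalForbidden⇒∣X∣≤4 X-forbidden C₄
      (p─q⊆p X M a∈X─M) (p─q⊆p X M b∈X─M) (proj₂ (x∈p∩q⁻ M X c∈M∩X)) (proj₂ (x∈p∩q⁻ M X d∈M∩X))
    where
    d∼ : ∀ {v} → v ∈ X ─ M → c ∼[ G ] v → d ∼[ G ] v
    d∼ {v} v∈X─M = to (M-module c d v (proj₁ (x∈p∩q⁻ M X c∈M∩X)) (proj₁ (x∈p∩q⁻ M X d∈M∩X))
                                     (x∈p─q⇒x∉q X M v∈X─M))

    C₄ : InducedC₄ a b c d
    C₄ = record
      { a≢b = a≢b ; c≢d = c≢d ; a≁b = a≁b ; c≁d = c≁d
      ; c∼a = c∼a ; c∼b = c∼b ; d∼a = d∼ a∈X─M c∼a ; d∼b = d∼ b∈X─M c∼b }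

  overlapping-module⇒∣X∣≤4 : IsModule G M → IsMinimalForbidden G X → Nonempty (X ─ M) →
                              1 < ∣ M ∩ X ∣ → ∣ X ∣ ≤ 4
  overlapping-module⇒∣X∣≤4 {M = M} {X = X} M-module X-forbidden X⊈M 1<∣M∩X∣
    with 1<∣p∣⇒two-elements (M ∩ X) 1<∣M∩X∣ | clique⊎non-edge (_∈? (M ∩ X))
  ... | y₁ , y₂ , y₁∈M∩X , y₂∈M∩X , y₁≢y₂ | inj₁ clique = ⊥-elim
    (Substitution.M∩X-clique⇒⊥ M-module X-forbidden y₁∈M∩X y₂∈M∩X y₁≢y₂ clique)
  ... | _ | inj₂ (c , d , c∈M∩X , d∈M∩X , c≢d , c≁d) =
    non-edge-in-module⇒∣X∣≤4 M-module X-forbidden X⊈M c∈M∩X d∈M∩X c≢d c≁d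

proposition4p4 : ∀ {n} (G : Graph n) (M X : Subset n) →
    IsModule G M → IsMinimalForbidden G X → 4 < ∣ X ∣ →
    X ⊆ M ⊎ ∣ M ∩ X ∣ ≤ 1
proposition4p4 G M X M-module X-forbidden 4<∣X∣ with ⊆⊎Nonempty─ X M | ∣ M ∩ X ∣ ≤? 1
... | inj₁ X⊆M     | _        = inj₁ X⊆M
... | inj₂ _       | yes ≤1   = inj₂ ≤1
... | inj₂ X⊈M   | no  ≰1   =
  ⊥-elim (<⇒≱ 4<∣X∣ (overlapping-module⇒∣X∣≤4 G M-module X-forbidden X⊈M (≰⇒> ≰1)))
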